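{- Let $G=(A,B,E)$ be a bipartite graph, let $s\ge|A|$, let $d\ge d^*:=\operatorname{deg}_{\max}\mathrm{semi}(A,B,E)$. Then the one-pass streaming algorithm $\textsc{incomplete}(G,s,d)$ described below uses $\tilde{\mathrm{O}}(s)$ space and outputs an incomplete $2d$-bounded semi-matching $S$ of $G$ such that $$|S|\ge\min\Big\{|A|\frac{d}{d+d^*}+\frac{ds}{|A|},\ |A|\Big\}.$$ Algorithm $\textsc{incomplete}(G,s,d)$: set $k=s/|A|$, $S_1=\varnothing$, $E'=\varnothing$. Make one pass over the stream of edges (in arbitrary order; edges not in $A\times B$ are ignored); for each edge $ab$ with $a\in A$, $b\in B$: if $\deg_{S_1}(a)=0$ and $\deg_{S_1}(b)<d$, add $ab$ to $S_1$; if $\deg_{E'}(a)<k$, add $ab$ to $E'$. After the pass, let $S_2$ be an incomplete $d$-bounded semi-matching of maximum cardinality in the graph with vertex sets $A\setminus A(S_1)$ and $B$ and edge set $\{ab\in E': a\in A\setminus A(S_1)\}$. Output $S=S_1\cup S_2$.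
   Context: $\deg_F(v)$ is the number of edges of $F$ at $v$; $\operatorname{deg}_{\max}F=\max_v\deg_F(v)$; $A(F)$ is the set of $A$-endpoints of edges of $F$. A semi-matching is $S\subseteq E$ with $\deg_S(a)=1$ for all $a\in A$; a degree-minimizing path with respect to $S$ is a path $b_1,a_1,b_2,\dots,a_{k-1},b_k$ with $(a_i,b_i)\in S$, $(a_i,b_{i+1})\in E\setminus S$, $\deg_S(b_1)\ge\deg_S(b_k)+2$; $\mathrm{semi}(A,B,E)$ is an optimal semi-matching (no degree-minimizing path), whose maximum degree is the minimum over all semi-matchings (presupposing one exists). An incomplete $d$-bounded semi-matching is $S\subseteq E$ with $\deg_S(a)\le1$ for $a\in A$ and $\deg_S(b)\le d$ for $b\in B$. $|B|$ is assumed polynomially bounded in $|A|$; $\tilde{\mathrm{O}}$ hides polylogarithmic factors. -}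

module Defs where

open import Data.Nat using (ℕ; zero; suc; _+_; _*_; _≤_; _<_; _⊔_; _<?_; _≟_)
open import Data.Fin using (Fin)
import Data.Fin as F
open import Data.Fin.Properties using () renaming (_≟_ to _≟ᶠ_)
open import Data.List using (List; []; _∷_; _++_; [_]; length; filter; foldl; foldr; map; allFin)
open import Data.List.Membership.Propositional using (_∈_)
open import Data.List.Relation.Unary.All using (All)
open import Data.List.Relation.Unary.Unique.Propositional using (Unique)
open import Data.Product using (Σ; _×_; _,_; proj₁; proj₂)
open import Data.Bool using (Bool; true; false; if_then_else_; _∧_)
open import Relation.Nullary.Decidable using (does)
open import Relation.Binary.PropositionalEquality using (_≡_)

-- A = Fin n, B = Fin m; an edge is a pair (a , b) with a ∈ A, b ∈ B.
Edge : ℕ → ℕ → Set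
Edge n m = Fin n × Fin m

module _ {n m : ℕ} where

  degA : List (Edge n m) → Fin n → ℕ
  degA F a = length (filter (λ e → proj₁ e ≟ᶠ a) F)

  degB : List (Edge n m) → Fin m → ℕ
  degB F b = length (filter (λ e → proj₂ e ≟ᶠ b) F)

  -- deg_max F = max over b ∈ B of deg_F(b)  (A-degrees are ≤ 1 for the sets considered)
  degMax : List (Edge n m) → ℕ
  degMax F = foldr _⊔_ 0 (map (degB F) (allFin m))

  SubsetOf : List (Edge n m) → List (Edge n m) → Set
  SubsetOf E F = All (_∈ E) F × Unique F

  SemiMatching : List (Edge n m) → List (Edge n m) → Set
  SemiMatching E S = SubsetOf E S × (∀ a → degA S a ≡ 1)

  OptimalDegree : List (Edge n m) → ℕ → Set
  OptimalDegree E dstar =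
    Σ (List (Edge n m)) (λ S → SemiMatching E S × degMax S ≡ dstar)
    × (∀ S → SemiMatching E S → dstar ≤ degMax S)

  IncompleteSM : ℕ → List (Edge n m) → List (Edge n m) → Set
  IncompleteSM d E S = SubsetOf E S × (∀ a → degA S a ≤ 1) × (∀ b → degB S b ≤ d)

  MaxIncompleteSM : ℕ → List (Edge n m) → List (Edge n m) → Set
  MaxIncompleteSM d E S =
    IncompleteSM d E S × (∀ T → IncompleteSM d E T → length T ≤ length S)

  -- Algorithm incomplete(G,s,d), one pass.  State = (S₁ , E′).
  -- The test deg_{E′}(a) < k with k = s/|A| = s/n is written deg_{E′}(a)·n < s.
  step : (s d : ℕ) → List (Edge n m) × List (Edge n m) → Edge n m
       → List (Edge n m) × List (Edge n m)
  step s d (S₁ , E′) (a , b) =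
    ( (if does (degA S₁ a ≟ 0) ∧ does (degB S₁ b <? d) then S₁ ++ [ (a , b) ] else S₁)
    , (if does (degA E′ a * n <? s) then E′ ++ [ (a , b) ] else E′) )

  pass : (s d : ℕ) → List (Edge n m) → List (Edge n m) × List (Edge n m)
  pass s d stream = foldl (step s d) ([] , []) stream

  restrict : List (Edge n m) → List (Edge n m) → List (Edge n m)
  restrict S₁ E′ = filter (λ e → degA S₁ (proj₁ e) ≟ 0) E′

module Submission where

-- The first phase adds an edge whenever both endpoints allow it, so S₁ is maximal: every edge of E
-- has an A-end matched by S₁ or a B-end of S₁-degree d. Let S* be an optimal semi-matching, with
-- B-degrees at most d*. The S*-edge at an S₁-free vertex ends at a saturated vertex, which receives
-- at most d* such edges but carries d edges of S₁; hence d (n − |S₁|) ≤ d* |S₁|.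
-- In the second phase, every S*-edge at a free vertex a with deg_{E′}(a) < k = s/n was stored in E′.
-- Completing these edges greedily in the second-phase graph yields a d-bounded semi-matching T with
-- |T| ≤ |S₂| that either covers every S₁-free vertex, so |S₁| + |S₂| ≥ n, or misses a free vertex
-- with at least k stored edges whose B-ends are all saturated in T, so |S₂| ≥ d k.

open import Defs
open import Data.Bool using (true; false; if_then_else_)
open import Data.Fin using (Fin; zero; suc; punchIn)
open import Data.Fin.Properties using (punchInᵢ≢i; any?) renaming (_≟_ to _≟ᶠ_)
open import Data.List using (List; []; _∷_; _++_; [_]; length; filter; foldl; foldr)
open import Data.List.Properties using (length-++; filter-++; filter-none; ++-assoc)
open import Data.List.Membership.Propositional using (_∈_)
open import Data.List.Membership.Propositional.Properties
  using (∈-filter⁺; ∈-filter⁻; ∈-++⁺ʳ; ∈-map⁺; ∈-allFin; ∈-length)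
open import Data.List.Relation.Binary.Sublist.Propositional using (_⊆_; []; _∷_; _∷ʳ_; ⊆-refl; ⊆-trans)
import Data.List.Relation.Binary.Sublist.Propositional.Properties as Sublist
open import Data.List.Relation.Unary.All as All using (All; []; _∷_)
import Data.List.Relation.Unary.All.Properties as All
open import Data.List.Relation.Unary.AllPairs using ([]; _∷_)
open import Data.List.Relation.Unary.Any using (here; there)
open import Data.List.Relation.Unary.Unique.Propositional using (Unique)
import Data.List.Relation.Unary.Unique.Propositional.Properties as Unique
open import Data.Nat using (ℕ; zero; suc; _+_; _*_; _≤_; _<_; _⊔_; _<?_; _≟_; z≤n; s≤s; >-nonZero)
open import Data.Nat.Properties
open import Data.Nat.Tactic.RingSolver using (solve-∀)
open import Data.Product using (∃; _×_; _,_; proj₁; proj₂)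
open import Data.Product.Properties using (×-≡,≡→≡)
open import Data.Sum using (_⊎_; inj₁; inj₂; map₂)
open import Function using (_∘_)
open import Relation.Binary.PropositionalEquality hiding ([_])
open import Relation.Nullary using (Dec; yes; no; ¬_; contradiction)
open import Relation.Nullary.Decidable using (does; _×-dec_)

open import Algebra.Properties.Semiring.Sum +-*-semiring
  using (sum; sum-syntax; ∑-distrib-+; *-distribˡ-sum; sum-cong-≗; sum-remove)

∑-mono-≤ : ∀ {k} {g h : Fin k → ℕ} → (∀ x → g x ≤ h x) → ∑[ x < k ] g x ≤ ∑[ x < k ] h x
∑-mono-≤ {zero}  g≤h = z≤n
∑-mono-≤ {suc k} g≤h = +-mono-≤ (g≤h zero) (∑-mono-≤ (g≤h ∘ suc))

∑-const : ∀ k c → ∑[ x < k ] c ≡ k * c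
∑-const zero    c = refl
∑-const (suc k) c = cong (c +_) (∑-const k c)

∑-single : ∀ {k} (y : Fin k) {g : Fin k → ℕ} {c} → g y ≡ c → (∀ x → y ≢ x → g x ≡ 0)
         → ∑[ x < k ] g x ≡ c
∑-single {suc k} y {g} {c} gy≡c g≡0 = begin
  sum g                             ≡⟨ sum-remove g ⟩
  g y + ∑[ j < k ] g (punchIn y j)  ≡⟨ cong₂ _+_ gy≡c (sum-cong-≗ λ j → g≡0 _ (punchInᵢ≢i y j ∘ sym)) ⟩
  c + ∑[ j < k ] 0                  ≡⟨ cong (c +_) (trans (∑-const k 0) (*-zeroʳ k)) ⟩
  c + 0                             ≡⟨ +-identityʳ c ⟩
  c                                 ∎
  where open ≡-Reasoning

1≤+ : ∀ x y → ¬ (x ≡ 0 × y ≡ 0) → 1 ≤ x + y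
1≤+ zero    zero    not-both = contradiction (refl , refl) not-both
1≤+ zero    (suc y) _        = s≤s z≤n
1≤+ (suc x) y       _        = s≤s z≤n

*-≤-*-if-pos : ∀ {c c′ x y} → x ≤ c′ → (1 ≤ x → c ≤ y) → c * x ≤ c′ * y
*-≤-*-if-pos {c} {c′} {zero}  {y} _    _   = subst (_≤ c′ * y) (sym (*-zeroʳ c)) z≤n
*-≤-*-if-pos {c} {c′} {suc x} {y} x≤c′ c≤y = begin
  c * suc x  ≤⟨ *-monoʳ-≤ c x≤c′ ⟩
  c * c′     ≡⟨ *-comm c c′ ⟩
  c′ * c     ≤⟨ *-monoʳ-≤ c′ (c≤y (s≤s z≤n)) ⟩
  c′ * y     ∎
  where open ≤-Reasoning

sum-of-ratio-bounds : ∀ {n d s D L₁ L₂} → n * d ≤ L₁ * D → d * s ≤ L₂ * n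
                    → n * n * d + d * s * D ≤ (L₁ + L₂) * D * n
sum-of-ratio-bounds {n} {d} {s} {D} {L₁} {L₂} first second = begin
  n * n * d + d * s * D      ≡⟨ cong (_+ d * s * D) (*-assoc n n d) ⟩
  n * (n * d) + d * s * D    ≤⟨ +-mono-≤ (*-monoʳ-≤ n first) (*-monoˡ-≤ D second) ⟩
  n * (L₁ * D) + L₂ * n * D  ≡⟨ rearrange n L₁ L₂ D ⟩
  (L₁ + L₂) * D * n          ∎
  where
  open ≤-Reasoning
  rearrange : ∀ n L₁ L₂ D → n * (L₁ * D) + L₂ * n * D ≡ (L₁ + L₂) * D * n
  rearrange = solve-∀

≤-foldr-⊔ : ∀ {x xs} → x ∈ xs → x ≤ foldr _⊔_ 0 xs
≤-foldr-⊔ {xs = y ∷ _} (here refl)  = m≤m⊔n y _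
≤-foldr-⊔ {xs = y ∷ _} (there x∈ys) = ≤-trans (≤-foldr-⊔ x∈ys) (m≤n⊔m y _)

-- degA and degB of Defs are, definitionally, count proj₁ and count proj₂.
module _ {X : Set} {k : ℕ} (f : X → Fin k) where

  count : List X → Fin k → ℕ
  count F x = length (filter (λ e → f e ≟ᶠ x) F)

  count-++ : ∀ F G x → count (F ++ G) x ≡ count F x + count G x
  count-++ F G x = trans (cong length (filter-++ (λ e → f e ≟ᶠ x) F G)) (length-++ (filter _ F))

  count-[]-≡ : ∀ {e x} → f e ≡ x → count [ e ] x ≡ 1
  count-[]-≡ {e} {x} fe≡x with f e ≟ᶠ x
  ... | yes _   = refl
  ... | no fe≢x = contradiction fe≡x fe≢x

  count-[]-≢ : ∀ {e x} → f e ≢ x → count [ e ] x ≡ 0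
  count-[]-≢ {e} {x} fe≢x with f e ≟ᶠ x
  ... | yes fe≡x = contradiction fe≡x fe≢x
  ... | no _     = refl

  count-++-[] : ∀ F e x → (f e ≡ x × count (F ++ [ e ]) x ≡ suc (count F x))
                          ⊎ count (F ++ [ e ]) x ≡ count F x
  count-++-[] F e x with f e ≟ᶠ x
  ... | yes fe≡x rewrite count-++ F [ e ] x | count-[]-≡ fe≡x = inj₁ (fe≡x , +-comm (count F x) 1)
  ... | no fe≢x  rewrite count-++ F [ e ] x | count-[]-≢ fe≢x = inj₂ (+-identityʳ (count F x))

  count-none : ∀ {F x} → All (λ e → f e ≢ x) F → count F x ≡ 0
  count-none none = cong length (filter-none _ none)

  count-mono : ∀ {F G} → F ⊆ G → ∀ x → count F x ≤ count G x
  count-mono F⊆G x = Sublist.length-mono-≤ (Sublist.filter⁺ _ _ (λ { refl p → p }) F⊆G)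

  count-pos : ∀ {e F} → e ∈ F → 1 ≤ count F (f e)
  count-pos e∈F = ∈-length (∈-filter⁺ (λ e′ → f e′ ≟ᶠ _) e∈F refl)

  count-witness : ∀ {F x} → 1 ≤ count F x → ∃ λ e → e ∈ F × f e ≡ x
  count-witness {F} {x} pos with filter (λ e → f e ≟ᶠ x) F in eq
  ... | e ∷ _ = e , ∈-filter⁻ (λ e → f e ≟ᶠ x) (subst (e ∈_) (sym eq) (here refl))

  count-filter : ∀ {P : X → Set} (P? : ∀ e → Dec (P e)) {F x} → (∀ {e} → f e ≡ x → P e)
               → count (filter P? F) x ≡ count F x
  count-filter P? {[]}    _      = refl
  count-filter P? {e ∷ F} {x} at-x⇒P with P? e
  ... | yes _ with f e ≟ᶠ x
  ...   | yes _ = cong suc (count-filter P? {F} at-x⇒P)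
  ...   | no _  = count-filter P? {F} at-x⇒P
  count-filter P? {e ∷ F} {x} at-x⇒P | no ¬Pe with f e ≟ᶠ x
  ...   | yes fe≡x = contradiction (at-x⇒P fe≡x) ¬Pe
  ...   | no _     = count-filter P? {F} at-x⇒P

  count≤1 : ∀ {F x} → Unique F → (∀ {e e′} → e ∈ F → e′ ∈ F → f e ≡ f e′ → e ≡ e′)
          → count F x ≤ 1
  count≤1 {[]}    _             _   = z≤n
  count≤1 {e ∷ F} {x} (e∉F ∷ uF) inj with f e ≟ᶠ x
  ... | no _     = count≤1 uF (λ p q → inj (there p) (there q))
  ... | yes refl = s≤s (≤-reflexive (count-none (All.tabulate λ e′∈F fe′≡fe →
                     All.lookup e∉F e′∈F (sym (inj (there e′∈F) (here refl) fe′≡fe)))))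

  length≡∑count : ∀ F → length F ≡ ∑[ x < k ] count F x
  length≡∑count []      = sym (trans (∑-const k 0) (*-zeroʳ k))
  length≡∑count (e ∷ F) = begin
    1 + length F                                     ≡⟨ cong₂ _+_ (sym ∑-count-[]) (length≡∑count F) ⟩
    ∑[ x < k ] count [ e ] x + ∑[ x < k ] count F x  ≡⟨ ∑-distrib-+ (count [ e ]) (count F) ⟨
    ∑[ x < k ] (count [ e ] x + count F x)           ≡⟨ sum-cong-≗ (count-++ [ e ] F) ⟨
    ∑[ x < k ] count (e ∷ F) x                       ∎
    where
    open ≡-Reasoning
    ∑-count-[] : ∑[ x < k ] count [ e ] x ≡ 1
    ∑-count-[] = ∑-single (f e) (count-[]-≡ refl) (λ _ → count-[]-≢)

  *-length≡∑ : ∀ c F → c * length F ≡ ∑[ x < k ] (c * count F x)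
  *-length≡∑ c F = trans (cong (c *_) (length≡∑count F)) (*-distribˡ-sum c (count F))

  *-length≤* : ∀ {c c′ F} → (∀ x → c * count F x ≤ c′) → c * length F ≤ k * c′
  *-length≤* {c} {c′} {F} bounded = begin
    c * length F                ≡⟨ *-length≡∑ c F ⟩
    ∑[ x < k ] (c * count F x)  ≤⟨ ∑-mono-≤ bounded ⟩
    ∑[ x < k ] c′               ≡⟨ ∑-const k c′ ⟩
    k * c′                      ∎
    where open ≤-Reasoning

  *-length≤*-length : ∀ {c c′ F G} → (∀ x → c * count F x ≤ c′ * count G x)
                    → c * length F ≤ c′ * length G
  *-length≤*-length {c} {c′} {F} {G} dominated = begin
    c * length F                 ≡⟨ *-length≡∑ c F ⟩
    ∑[ x < k ] (c * count F x)   ≤⟨ ∑-mono-≤ dominated ⟩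
    ∑[ x < k ] (c′ * count G x)  ≡⟨ *-length≡∑ c′ G ⟨
    c′ * length G                ∎
    where open ≤-Reasoning

  length-covering : ∀ {F} → (∀ x → 1 ≤ count F x) → k ≤ length F
  length-covering {F} covering = begin
    k                     ≡⟨ trans (∑-const k 1) (*-identityʳ k) ⟨
    ∑[ x < k ] 1          ≤⟨ ∑-mono-≤ covering ⟩
    ∑[ x < k ] count F x  ≡⟨ length≡∑count F ⟨
    length F              ∎
    where open ≤-Reasoning

Unique-⊆ : ∀ {X : Set} {xs ys : List X} → xs ⊆ ys → Unique ys → Unique xs
Unique-⊆ []         []         = []
Unique-⊆ (_ ∷ʳ p)   (_ ∷ u)    = Unique-⊆ p u
Unique-⊆ (refl ∷ p) (y∉ys ∷ u) = Sublist.All-resp-⊆ p y∉ys ∷ Unique-⊆ p u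

-- The tests in `step` normalise (`does (x ≟ 0)` becomes `x ≡ᵇ 0`), so `with` cannot abstract
-- over them; case analysis on them goes through this eliminator instead.
if-does : ∀ {A P : Set} (C : A → Set) (p : Dec P) {x y : A}
        → (P → C x) → (¬ P → C y) → C (if does p then x else y)
if-does C (yes p) cx _  = cx p
if-does C (no ¬p) _  cy = cy ¬p

if-snoc-⊇ : ∀ {X : Set} b (T : List X) x → T ⊆ (if b then T ++ [ x ] else T)
if-snoc-⊇ true  T x = Sublist.++⁺ʳ [ x ] ⊆-refl
if-snoc-⊇ false T x = ⊆-refl

if-snoc-⊆ : ∀ {X : Set} b (T : List X) x → (if b then T ++ [ x ] else T) ⊆ T ++ [ x ]
if-snoc-⊆ true  T x = ⊆-refl
if-snoc-⊆ false T x = Sublist.++⁺ʳ [ x ] ⊆-refl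

module Growing {X : Set} (add : List X → X → List X) (add-⊇ : ∀ T x → T ⊆ add T x) where

  foldl-⊇ : ∀ T xs → T ⊆ foldl add T xs
  foldl-⊇ T []       = ⊆-refl
  foldl-⊇ T (x ∷ xs) = ⊆-trans (add-⊇ T x) (foldl-⊇ (add T x) xs)

  foldl-⊆-++ : (∀ T x → add T x ⊆ T ++ [ x ]) → ∀ T xs → foldl add T xs ⊆ T ++ xs
  foldl-⊆-++ add-⊆ T []       = Sublist.++⁺ʳ [] ⊆-refl
  foldl-⊆-++ add-⊆ T (x ∷ xs) = subst (foldl add T (x ∷ xs) ⊆_) (++-assoc T [ x ] xs)
    (⊆-trans (foldl-⊆-++ add-⊆ (add T x) xs) (Sublist.++⁺ (add-⊆ T x) ⊆-refl))

  foldl-invariant : (Q : List X → Set) → ∀ {T} xs → All (λ x → ∀ {T} → Q T → Q (add T x)) xs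
                  → Q T → Q (foldl add T xs)
  foldl-invariant Q []       []         qT = qT
  foldl-invariant Q (x ∷ xs) (qx ∷ qxs) qT = foldl-invariant Q xs qxs (qx qT)

  foldl-persistent : (P : List X → X → Set) → (∀ {T T′ x} → T ⊆ T′ → P T x → P T′ x)
                   → (∀ T x → P (add T x) x) → ∀ T xs → All (P (foldl add T xs)) xs
  foldl-persistent P mono achieved T []       = []
  foldl-persistent P mono achieved T (x ∷ xs) =
    mono (foldl-⊇ (add T x) xs) (achieved T x) ∷ foldl-persistent P mono achieved (add T x) xs

module _ {n m : ℕ} where

  Addable : ℕ → List (Edge n m) → Edge n m → Set
  Addable d T (a , b) = degA T a ≡ 0 × degB T b < d

  addable? : ∀ d T e → Dec (Addable d T e)
  addable? d T (a , b) = (degA T a ≟ 0) ×-dec (degB T b <? d)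

  greedyAdd : ℕ → List (Edge n m) → Edge n m → List (Edge n m)
  greedyAdd d T e = if does (addable? d T e) then T ++ [ e ] else T

  storeAdd : ℕ → List (Edge n m) → Edge n m → List (Edge n m)
  storeAdd s K e = if does (degA K (proj₁ e) * n <? s) then K ++ [ e ] else K

  greedy : ℕ → List (Edge n m) → List (Edge n m) → List (Edge n m)
  greedy d = foldl (greedyAdd d)

  store : ℕ → List (Edge n m) → List (Edge n m)
  store s = foldl (storeAdd s) []

  foldl-step : ∀ s d S K xs → foldl (step s d) (S , K) xs ≡ (greedy d S xs , foldl (storeAdd s) K xs)
  foldl-step s d S K []       = refl
  foldl-step s d S K (x ∷ xs) = foldl-step s d (greedyAdd d S x) (storeAdd s K x) xs

  pass≡ : ∀ s d E → pass s d E ≡ (greedy d [] E , store s E)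
  pass≡ s d E = foldl-step s d [] [] E

  Blocked : ℕ → List (Edge n m) → Edge n m → Set
  Blocked d T (a , b) = 1 ≤ degA T a ⊎ d ≤ degB T b

  Blocked-mono : ∀ {d T T′ e} → T ⊆ T′ → Blocked d T e → Blocked d T′ e
  Blocked-mono T⊆T′ (inj₁ covered)   = inj₁ (≤-trans covered (count-mono proj₁ T⊆T′ _))
  Blocked-mono T⊆T′ (inj₂ saturated) = inj₂ (≤-trans saturated (count-mono proj₂ T⊆T′ _))

  IncompleteSM-++-[] : ∀ {d} {F T : List (Edge n m)} {e} → e ∈ F → Addable d T e
                     → IncompleteSM d F T → IncompleteSM d F (T ++ [ e ])
  IncompleteSM-++-[] {d} {F} {T} {e} e∈F (a-free , b-free) ((T⊆F , uT) , T-degA , T-degB) =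
    (All.++⁺ T⊆F (e∈F ∷ []) , Unique.++⁺ uT ([] ∷ []) disjoint) , degA≤1 , degB≤d
    where
    disjoint : ∀ {v} → ¬ (v ∈ T × v ∈ [ e ])
    disjoint (e∈T , here refl) = m<n⇒n≢0 (count-pos proj₁ e∈T) a-free

    degA≤1 : ∀ a → degA (T ++ [ e ]) a ≤ 1
    degA≤1 a with count-++-[] proj₁ T e a
    ... | inj₁ (refl , eq) = ≤-reflexive (trans eq (cong suc a-free))
    ... | inj₂ eq          = subst (_≤ 1) (sym eq) (T-degA a)

    degB≤d : ∀ b → degB (T ++ [ e ]) b ≤ d
    degB≤d b with count-++-[] proj₂ T e b
    ... | inj₁ (refl , eq) = subst (_≤ d) (sym eq) b-free
    ... | inj₂ eq          = subst (_≤ d) (sym eq) (T-degB b)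

  greedyAdd-⊇ : ∀ d T e → T ⊆ greedyAdd d T e
  greedyAdd-⊇ d T e = if-snoc-⊇ _ T e

  greedyAdd-blocks : ∀ d T e → Blocked d (greedyAdd d T e) e
  greedyAdd-blocks d T e = if-does (λ T′ → Blocked d T′ e) (addable? d T e)
    (λ _ → inj₁ (count-pos proj₁ (∈-++⁺ʳ T (here refl))))
    (λ ¬addable → blocked ¬addable (degA T (proj₁ e) ≟ 0))
    where
    blocked : ¬ Addable d T e → Dec (degA T (proj₁ e) ≡ 0) → Blocked d T e
    blocked ¬addable (yes a-free) = inj₂ (≮⇒≥ λ b-free → ¬addable (a-free , b-free))
    blocked ¬addable (no a-used)  = inj₁ (n≢0⇒n>0 a-used)

  greedyAdd-valid : ∀ {d} {F T : List (Edge n m)} {e} → e ∈ F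
                  → IncompleteSM d F T → IncompleteSM d F (greedyAdd d T e)
  greedyAdd-valid {d} {F} {T} {e} e∈F valid = if-does (IncompleteSM d F) (addable? d T e)
    (λ addable → IncompleteSM-++-[] e∈F addable valid) (λ _ → valid)

  greedy-maximal : ∀ d {F} T → IncompleteSM d F T
                 → IncompleteSM d F (greedy d T F) × T ⊆ greedy d T F × All (Blocked d (greedy d T F)) F
  greedy-maximal d {F} T valid =
      foldl-invariant (IncompleteSM d F) F (All.tabulate λ x∈F → greedyAdd-valid x∈F) valid
    , foldl-⊇ T F
    , foldl-persistent (Blocked d) Blocked-mono (greedyAdd-blocks d) T F
    where open Growing (greedyAdd d) (greedyAdd-⊇ d)

  greedy-maximal-[] : ∀ d E → IncompleteSM d E (greedy d [] E) × All (Blocked d (greedy d [] E)) E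
  greedy-maximal-[] d E with greedy-maximal d [] (([] , []) , (λ _ → z≤n) , (λ _ → z≤n))
  ... | valid , _ , blocked = valid , blocked

  Stored : ℕ → List (Edge n m) → Edge n m → Set
  Stored s K e = e ∈ K ⊎ s ≤ degA K (proj₁ e) * n

  Stored-mono : ∀ {s K K′ e} → K ⊆ K′ → Stored s K e → Stored s K′ e
  Stored-mono K⊆K′ (inj₁ e∈K)  = inj₁ (Sublist.Any-resp-⊆ K⊆K′ e∈K)
  Stored-mono K⊆K′ (inj₂ full) = inj₂ (≤-trans full (*-monoˡ-≤ n (count-mono proj₁ K⊆K′ _)))

  QuotaRespected : ℕ → List (Edge n m) → Set
  QuotaRespected s K = ∀ a → degA K a * n ≤ s + n

  storeAdd-⊇ : ∀ s K e → K ⊆ storeAdd s K e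
  storeAdd-⊇ s K e = if-snoc-⊇ _ K e

  storeAdd-⊆ : ∀ s K e → storeAdd s K e ⊆ K ++ [ e ]
  storeAdd-⊆ s K e = if-snoc-⊆ _ K e

  storeAdd-stores : ∀ s K e → Stored s (storeAdd s K e) e
  storeAdd-stores s K e = if-does (λ K′ → Stored s K′ e) (degA K (proj₁ e) * n <? s)
    (λ _ → inj₁ (∈-++⁺ʳ K (here refl))) (inj₂ ∘ ≮⇒≥)

  storeAdd-quota : ∀ s {K} e → QuotaRespected s K → QuotaRespected s (storeAdd s K e)
  storeAdd-quota s {K} e respected =
    if-does (QuotaRespected s) (degA K (proj₁ e) * n <? s) added λ _ → respected
    where
    added : degA K (proj₁ e) * n < s → QuotaRespected s (K ++ [ e ])
    added below a with count-++-[] proj₁ K e a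
    ... | inj₁ (refl , eq) = subst (λ c → c * n ≤ s + n) (sym eq)
                               (≤-trans (+-monoʳ-≤ n (<⇒≤ below)) (≤-reflexive (+-comm n s)))
    ... | inj₂ eq          = subst (λ c → c * n ≤ s + n) (sym eq) (respected a)

  store-properties : ∀ s E → store s E ⊆ E × QuotaRespected s (store s E)
                           × All (Stored s (store s E)) E
  store-properties s E =
      foldl-⊆-++ (storeAdd-⊆ s) [] E
    , foldl-invariant (QuotaRespected s) E (All.universal (λ x {K} → storeAdd-quota s x) E)
        (λ _ → z≤n)
    , foldl-persistent (Stored s) Stored-mono (storeAdd-stores s) [] E
    where open Growing (storeAdd s) (storeAdd-⊇ s)

  pass-space : ∀ {s} {S K : List (Edge n m)} → 1 ≤ n → n ≤ s
             → (∀ a → degA S a ≤ 1) → QuotaRespected s K → length S + length K ≤ 3 * s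
  pass-space {s} {S} {K} 1≤n n≤s S-degA quota = begin
    length S + length K  ≤⟨ +-mono-≤ S≤n K≤s+n ⟩
    n + (s + n)          ≤⟨ +-mono-≤ n≤s (+-monoʳ-≤ s n≤s) ⟩
    s + (s + s)          ≡⟨ cong (λ t → s + (s + t)) (+-identityʳ s) ⟨
    3 * s                ∎
    where
    open ≤-Reasoning
    S≤n : length S ≤ n
    S≤n = subst₂ _≤_ (+-identityʳ (length S)) (*-identityʳ n)
            (*-length≤* proj₁ {1} {1} {S} λ a → subst (_≤ 1) (sym (+-identityʳ (degA S a))) (S-degA a))

    K≤s+n : length K ≤ s + n
    K≤s+n = *-cancelˡ-≤ n {{>-nonZero 1≤n}}
              (*-length≤* proj₁ {n} {s + n} {K} λ a → subst (_≤ s + n) (*-comm (degA K a) n) (quota a))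

  IncompleteSM-++-restrict : ∀ {d d′} {E S K T : List (Edge n m)} → IncompleteSM d E S → K ⊆ E
                           → IncompleteSM d′ (restrict S K) T → IncompleteSM (d + d′) E (S ++ T)
  IncompleteSM-++-restrict {d} {d′} {E} {S} {K} {T}
    ((S⊆E , uS) , S-degA , S-degB) K⊆E ((T⊆F , uT) , T-degA , T-degB) =
    (All.++⁺ S⊆E (All.map T⊆E T⊆F) , Unique.++⁺ uS uT disjoint) , degA≤1 , degB≤d+d′
    where
    free? : ∀ e → Dec (degA S (proj₁ e) ≡ 0)
    free? e = degA S (proj₁ e) ≟ 0

    T⊆E : ∀ {e} → e ∈ restrict S K → e ∈ E
    T⊆E e∈F = Sublist.Any-resp-⊆ K⊆E (proj₁ (∈-filter⁻ free? {xs = K} e∈F))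

    T-free : ∀ {e} → e ∈ T → degA S (proj₁ e) ≡ 0
    T-free e∈T = proj₂ (∈-filter⁻ free? {xs = K} (All.lookup T⊆F e∈T))

    disjoint : ∀ {e} → ¬ (e ∈ S × e ∈ T)
    disjoint (e∈S , e∈T) = m<n⇒n≢0 (count-pos proj₁ e∈S) (T-free e∈T)

    T-avoids : ∀ {a} → degA S a ≢ 0 → degA T a ≡ 0
    T-avoids a-used = count-none proj₁ (All.tabulate λ e∈T e-at-a →
      a-used (subst (λ a → degA S a ≡ 0) e-at-a (T-free e∈T)))

    degA≤1 : ∀ a → degA (S ++ T) a ≤ 1
    degA≤1 a = subst (_≤ 1) (sym (count-++ proj₁ S T a)) (one-side (degA S a ≟ 0))
      where
      one-side : Dec (degA S a ≡ 0) → degA S a + degA T a ≤ 1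
      one-side (yes a-free) rewrite a-free           = T-degA a
      one-side (no a-used)  rewrite T-avoids a-used = subst (_≤ 1) (sym (+-identityʳ _)) (S-degA a)

    degB≤d+d′ : ∀ b → degB (S ++ T) b ≤ d + d′
    degB≤d+d′ b = subst (_≤ d + d′) (sym (count-++ proj₂ S T b)) (+-mono-≤ (S-degB b) (T-degB b))

  degB≤degMax : ∀ S b → degB S b ≤ degMax {n} {m} S
  degB≤degMax S b = ≤-foldr-⊔ (∈-map⁺ (degB S) (∈-allFin b))

  optimal-witness : ∀ {E : List (Edge n m)} {dstar} → OptimalDegree E dstar
                  → ∃ λ S* → SemiMatching E S* × (∀ b → degB S* b ≤ dstar)
  optimal-witness ((S* , semi , degMax≡dstar) , _) =
    S* , semi , λ b → subst (degB S* b ≤_) degMax≡dstar (degB≤degMax S* b)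

  maximal-coverage : ∀ {d dstar} {E S S* : List (Edge n m)} → All (Blocked d S) E
                   → SemiMatching E S* → (∀ b → degB S* b ≤ dstar)
                   → n * d ≤ length S * (d + dstar)
  maximal-coverage {d} {dstar} {E} {S} {S*} blocked ((S*⊆E , _) , S*-degA) S*-degB = begin
    n * d                            ≤⟨ *-monoˡ-≤ d n≤S+P ⟩
    (length S + length P) * d        ≡⟨ *-distribʳ-+ d (length S) (length P) ⟩
    length S * d + length P * d      ≡⟨ cong (length S * d +_) (*-comm (length P) d) ⟩
    length S * d + d * length P      ≤⟨ +-monoʳ-≤ (length S * d) d*P≤dstar*S ⟩
    length S * d + dstar * length S  ≡⟨ cong (length S * d +_) (*-comm dstar (length S)) ⟩
    length S * d + length S * dstar  ≡⟨ *-distribˡ-+ (length S) d dstar ⟨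
    length S * (d + dstar)           ∎
    where
    open ≤-Reasoning
    free? : ∀ e → Dec (degA S (proj₁ e) ≡ 0)
    free? e = degA S (proj₁ e) ≟ 0

    P : List (Edge n m)
    P = filter free? S*

    P-covers-free : ∀ {a} → degA S a ≡ 0 → 1 ≤ degA P a
    P-covers-free {a} a-free with count-witness proj₁ {S*} (≤-reflexive (sym (S*-degA a)))
    ... | e , e∈S* , refl = count-pos proj₁ {F = P} (∈-filter⁺ free? e∈S* a-free)

    n≤S+P : n ≤ length S + length P
    n≤S+P = subst (n ≤_) (length-++ S) (length-covering proj₁ {S ++ P} λ a →
      subst (1 ≤_) (sym (count-++ proj₁ S P a)) (1≤+ _ _ λ (a-free , a∉P) →
        m<n⇒n≢0 (P-covers-free a-free) a∉P))

    saturated : ∀ {e} → e ∈ P → d ≤ degB S (proj₂ e)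
    saturated e∈P with ∈-filter⁻ free? e∈P
    ... | e∈S* , a-free with All.lookup blocked (All.lookup S*⊆E e∈S*)
    ...   | inj₁ a-covered = contradiction a-free (m<n⇒n≢0 a-covered)
    ...   | inj₂ b-full    = b-full

    d*P≤dstar*S : d * length P ≤ dstar * length S
    d*P≤dstar*S = *-length≤*-length proj₂ {d} {dstar} {P} {S} λ b →
      *-≤-*-if-pos (≤-trans (count-mono proj₂ (Sublist.filter-⊆ free? S*) b) (S*-degB b)) λ pos →
        let e , e∈P , e-at-b = count-witness proj₂ {P} pos
        in subst (λ b → d ≤ degB S b) e-at-b (saturated e∈P)

  unmatched-vertex : ∀ {d} {F T : List (Edge n m)} {a} → Unique F → All (Blocked d T) F
                   → degA T a ≡ 0 → d * degA F a ≤ length T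
  unmatched-vertex {d} {F} {T} {a} uF blocked a-free =
    subst (d * length N ≤_) (*-identityˡ (length T)) (*-length≤*-length proj₂ {d} {1} {N} {T} λ b →
      *-≤-*-if-pos (count≤1 proj₂ (Unique.filter⁺ at-a? uF) same-a) λ pos →
        let e , e∈N , e-at-b = count-witness proj₂ {N} pos
        in subst (λ b → d ≤ degB T b) e-at-b (saturated e∈N))
    where
    at-a? : ∀ e → Dec (proj₁ e ≡ a)
    at-a? e = proj₁ e ≟ᶠ a

    N : List (Edge n m)
    N = filter at-a? F

    same-a : ∀ {e e′} → e ∈ N → e′ ∈ N → proj₂ e ≡ proj₂ e′ → e ≡ e′
    same-a e∈N e′∈N same-b = ×-≡,≡→≡ (trans (at-a e∈N) (sym (at-a e′∈N)) , same-b)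
      where
      at-a : ∀ {e} → e ∈ N → proj₁ e ≡ a
      at-a e∈N = proj₂ (∈-filter⁻ at-a? {xs = F} e∈N)

    saturated : ∀ {e} → e ∈ N → d ≤ degB T (proj₂ e)
    saturated e∈N with ∈-filter⁻ at-a? {xs = F} e∈N
    ... | e∈F , refl with All.lookup blocked e∈F
    ...   | inj₁ a-covered = contradiction a-free (m<n⇒n≢0 a-covered)
    ...   | inj₂ b-full    = b-full

  second-phase : ∀ {s d} {E S K S* S₂ : List (Edge n m)}
               → SemiMatching E S* → (∀ b → degB S* b ≤ d)
               → Unique K → All (Stored s K) E → MaxIncompleteSM d (restrict S K) S₂
               → n ≤ length S + length S₂ ⊎ d * s ≤ length S₂ * n
  second-phase {s} {d} {E} {S} {K} {S*} {S₂} ((S*⊆E , uS*) , S*-degA) S*-degB uK stored (_ , S₂-max) =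
    conclude (any? λ a → (degA S a ≟ 0) ×-dec (degA T a ≟ 0))
    where
    free? : ∀ e → Dec (degA S (proj₁ e) ≡ 0)
    free? e = degA S (proj₁ e) ≟ 0

    F : List (Edge n m)
    F = restrict S K

    small? : ∀ e → Dec (degA S (proj₁ e) ≡ 0 × degA K (proj₁ e) * n < s)
    small? e = free? e ×-dec (degA K (proj₁ e) * n <? s)

    uF : Unique F
    uF = Unique.filter⁺ free? uK

    T₀ : List (Edge n m)
    T₀ = filter small? S*

    T₀⊆F : ∀ {e} → e ∈ T₀ → e ∈ F
    T₀⊆F e∈T₀ with ∈-filter⁻ small? {xs = S*} e∈T₀
    ... | e∈S* , a-free , a-small with All.lookup stored (All.lookup S*⊆E e∈S*)
    ...   | inj₁ e∈K    = ∈-filter⁺ free? e∈K a-free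
    ...   | inj₂ a-full = contradiction a-full (<⇒≱ a-small)

    T₀-valid : IncompleteSM d F T₀
    T₀-valid = (All.tabulate T₀⊆F , Unique.filter⁺ small? uS*)
             , (λ a → ≤-trans (count-mono proj₁ T₀⊆S* a) (≤-reflexive (S*-degA a)))
             , (λ b → ≤-trans (count-mono proj₂ T₀⊆S* b) (S*-degB b))
      where T₀⊆S* = Sublist.filter-⊆ small? S*

    T₀-covers : ∀ {a} → degA S a ≡ 0 → degA K a * n < s → 1 ≤ degA T₀ a
    T₀-covers {a} a-free a-small with count-witness proj₁ {S*} (≤-reflexive (sym (S*-degA a)))
    ... | e , e∈S* , refl = count-pos proj₁ {F = T₀} (∈-filter⁺ small? e∈S* (a-free , a-small))

    T : List (Edge n m)
    T = greedy d T₀ F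

    T-maximal : IncompleteSM d F T × T₀ ⊆ T × All (Blocked d T) F
    T-maximal = greedy-maximal d T₀ T₀-valid

    T₀⊆T : T₀ ⊆ T
    T₀⊆T = proj₁ (proj₂ T-maximal)

    T-blocked : All (Blocked d T) F
    T-blocked = proj₂ (proj₂ T-maximal)

    T≤S₂ : length T ≤ length S₂
    T≤S₂ = S₂-max T (proj₁ T-maximal)

    large : ∀ {a} → degA S a ≡ 0 → degA T a ≡ 0 → s ≤ degA K a * n
    large {a} a-free a-unmatched = ≮⇒≥ λ a-small →
      m<n⇒n≢0 (≤-trans (T₀-covers a-free a-small) (count-mono proj₁ T₀⊆T a)) a-unmatched

    conclude : Dec (∃ λ a → degA S a ≡ 0 × degA T a ≡ 0)
             → n ≤ length S + length S₂ ⊎ d * s ≤ length S₂ * n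
    conclude (yes (a , a-free , a-unmatched)) = inj₂ (begin
      d * s               ≤⟨ *-monoʳ-≤ d (large a-free a-unmatched) ⟩
      d * (degA K a * n)  ≡⟨ *-assoc d (degA K a) n ⟨
      d * degA K a * n    ≡⟨ cong (λ c → d * c * n) (count-filter proj₁ free? {K} λ { refl → a-free }) ⟨
      d * degA F a * n    ≤⟨ *-monoˡ-≤ n (unmatched-vertex {d} {F} {T} uF T-blocked a-unmatched) ⟩
      length T * n        ≤⟨ *-monoˡ-≤ n T≤S₂ ⟩
      length S₂ * n       ∎)
      where open ≤-Reasoning
    conclude (no none) = inj₁ (≤-trans
      (subst (n ≤_) (length-++ S) (length-covering proj₁ {S ++ T} λ a →
        subst (1 ≤_) (sym (count-++ proj₁ S T a)) (1≤+ _ _ λ both → none (a , both))))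
      (+-monoʳ-≤ (length S) T≤S₂))

  size-bound : ∀ {s d dstar} {S T : List (Edge n m)} → n * d ≤ length S * (d + dstar)
             → n ≤ length S + length T ⊎ d * s ≤ length T * n
             → n ≤ length (S ++ T)
               ⊎ n * n * d + d * s * (d + dstar) ≤ length (S ++ T) * (d + dstar) * n
  size-bound {s} {d} {dstar} {S} {T} first second rewrite length-++ S {T} =
    map₂ (sum-of-ratio-bounds {n} {d} {s} {d + dstar} {length S} {length T} first) second

lemma2 : ∀ {n m : ℕ} → 1 ≤ n → (E : List (Edge n m)) → Unique E
    → (s d dstar : ℕ) → n ≤ s → OptimalDegree E dstar → dstar ≤ d
    → (length (proj₁ (pass s d E)) + length (proj₂ (pass s d E)) ≤ 3 * s)
      × (∀ S₂ → MaxIncompleteSM d (restrict (proj₁ (pass s d E)) (proj₂ (pass s d E))) S₂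
         → IncompleteSM (2 * d) E (proj₁ (pass s d E) ++ S₂)
           × (n ≤ length (proj₁ (pass s d E) ++ S₂)
              ⊎ n * n * d + d * s * (d + dstar)
                ≤ length (proj₁ (pass s d E) ++ S₂) * (d + dstar) * n))
lemma2 {n} {m} 1≤n E uE s d dstar n≤s optimal dstar≤d rewrite pass≡ s d E
  with optimal-witness optimal | greedy-maximal-[] d E | store-properties s E
... | S* , S*-semi , S*-degB | S₁-valid , S₁-blocked | E′⊆E , E′-quota , E′-stored =
    pass-space {S = S₁} {E′} 1≤n n≤s (proj₁ (proj₂ S₁-valid)) E′-quota
  , λ S₂ (S₂-valid , S₂-max) →
      subst (λ D → IncompleteSM D E (S₁ ++ S₂)) (cong (d +_) (sym (+-identityʳ d)))
        (IncompleteSM-++-restrict S₁-valid E′⊆E S₂-valid)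
    , size-bound {S = S₁} (maximal-coverage {E = E} {S₁} S₁-blocked S*-semi S*-degB)
        (second-phase {E = E} {S₁} S*-semi (λ b → ≤-trans (S*-degB b) dstar≤d)
                      (Unique-⊆ E′⊆E uE) E′-stored (S₂-valid , S₂-max))
  where
  S₁ E′ : List (Edge n m)
  S₁ = greedy d [] E
  E′ = store s E
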